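{- Assume the presentation axiom: every set is the image of a projective set. Then every predicate is instance equivalent to a predicate on a projective set.
   Context: Work in intuitionistic higher-order logic (e.g. the internal language of an elementary topos), without excluded middle and without countable choice. A set $I$ is projective when every $I$-indexed family $(A_i)_{i\in I}$ of inhabited sets has a choice function (i.e. $\prod_{i\in I}A_i$ is inhabited). A predicate $\phi$ on a set $A$ is a subset of $A$. A predicate $\phi$ on $A$ is instance reducible to a predicate $\psi$ on $B$, written $\phi\sqsubseteq\psi$, when $\forall x\in A\,\exists y\in B\,(\psi(y)\Rightarrow\phi(x))$; $\phi$ and $\psi$ are instance equivalent when $\phi\sqsubseteq\psi$ and $\psi\sqsubseteq\phi$. -}

module Defs where

open import Level using (Level; _⊔_; Setω) renaming (suc to lsuc)
open import Data.Product using (Σ; _×_; _,_)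
open import Relation.Binary.PropositionalEquality using (_≡_)

isProp : ∀ {ℓ} → Set ℓ → Set ℓ
isProp P = (x y : P) → x ≡ y

-- Propositional truncation, taken as an abstract structure (it is not
-- definable in --safe Agda).  The existential quantifier of the internal
-- (intuitionistic higher-order) logic is  ∃ x. Q x  :=  ∥ Σ X Q ∥ .
record PropTrunc : Setω where
  field
    ∥_∥    : ∀ {ℓ} → Set ℓ → Set ℓ
    ∣_∣    : ∀ {ℓ} {A : Set ℓ} → A → ∥ A ∥
    squash : ∀ {ℓ} {A : Set ℓ} → isProp ∥ A ∥
    rec    : ∀ {ℓ ℓ'} {A : Set ℓ} {P : Set ℓ'} → isProp P → (A → P) → ∥ A ∥ → P

module Internal (T : PropTrunc) where
  open PropTrunc T

  Ex : ∀ {ℓ ℓ'} (X : Set ℓ) → (X → Set ℓ') → Set (ℓ ⊔ ℓ')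
  Ex X Q = ∥ Σ X Q ∥

  Inhabited : Set → Set
  Inhabited X = ∥ X ∥

  Projective : Set → Set₁
  Projective I = (A : I → Set) → ((i : I) → Inhabited (A i)) → Inhabited ((i : I) → A i)

  Surjective : {P A : Set} → (P → A) → Set
  Surjective {P} {A} f = (a : A) → Ex P (λ p → f p ≡ a)

  PresentationAxiom : Set₁
  PresentationAxiom =
    (A : Set) → Ex Set (λ P → Projective P × Ex (P → A) (λ f → Surjective f))

  record Pred (A : Set) : Set₁ where
    field
      holds   : A → Set
      isPropP : (x : A) → isProp (holds x)
  open Pred public

  _⊑_ : {A B : Set} → Pred A → Pred B → Set
  _⊑_ {A} {B} φ ψ = (x : A) → Ex B (λ y → holds ψ y → holds φ x)

  InstanceEquivalent : {A B : Set} → Pred A → Pred B → Set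
  InstanceEquivalent φ ψ = (φ ⊑ ψ) × (ψ ⊑ φ)

-- Pull φ back along a surjection f from a projective presentation of A:
-- an instance x of φ is matched by any preimage p of x, and an instance p
-- of the pullback by f p.
module Submission where

open import Defs
open import Data.Product using (Σ; _×_; _,_)
open import Function using (id)
open import Relation.Binary.PropositionalEquality using (_≡_; subst)

module _ (T : PropTrunc) where
  open PropTrunc T
  open Internal T

  pullback : {P A : Set} → (P → A) → Pred A → Pred P
  pullback f φ = record
    { holds   = λ p → holds φ (f p)
    ; isPropP = λ p → isPropP φ (f p) }

  pullback-⊑ : {P A : Set} (f : P → A) (φ : Pred A) → pullback f φ ⊑ φ
  pullback-⊑ f φ p = ∣ f p , id ∣

  ⊑-pullback : {P A : Set} {f : P → A} → Surjective f → (φ : Pred A) → φ ⊑ pullback f φ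
  ⊑-pullback surj φ x = rec squash (λ { (p , fp≡x) → ∣ p , subst (holds φ) fp≡x ∣ }) (surj x)

  pullback-equivalent : {P A : Set} {f : P → A} → Surjective f → (φ : Pred A) →
    InstanceEquivalent φ (pullback f φ)
  pullback-equivalent {f = f} surj φ = ⊑-pullback surj φ , pullback-⊑ f φ

proposition2p7 : (T : PropTrunc) → let open Internal T in
    PresentationAxiom →
    (A : Set) (φ : Pred A) →
    Ex Set (λ B → Projective B × Ex (Pred B) (λ ψ → InstanceEquivalent φ ψ))
proposition2p7 T presentation A φ =
  rec squash (λ { (P , projective , presented) →
    rec squash (λ { (f , surj) →
      ∣ P , projective , ∣ pullback T f φ , pullback-equivalent T surj φ ∣ ∣ })
      presented })
    (presentation A)
  where
  open PropTrunc T
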